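{- Let $G$ be a finite digraph without $2$-cycles such that every edge of $G$ is dominated and every vertex has out-degree $3$. Then every vertex of $G$ has in-degree $3$.
   Context: Digraphs have no loops and no parallel arcs in the same direction. A $2$-cycle is a pair of arcs $u\to v$, $v\to u$. An edge $u\to v$ is dominated if $u$ and $v$ have a common in-neighbor, i.e. there is $w$ with $w\to u$ and $w\to v$. -}

module Defs where

open import Data.Nat using (ℕ)
open import Data.Bool using (Bool; true; false)
open import Data.Fin using (Fin)
open import Data.List using (List; length; filter; allFin)
open import Data.Empty using (⊥)
open import Data.Product using (∃; _×_)
open import Relation.Binary.PropositionalEquality using (_≡_)
open import Data.Bool.Properties using (T?)
open import Data.Bool using (T)

-- A finite digraph on vertex set Fin n, given by its adjacency (arc) relation.
-- Arcs form a relation, so there are no parallel arcs in the same direction;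
-- loops are excluded explicitly.
record Digraph : Set where
  field
    n     : ℕ
    arc   : Fin n → Fin n → Bool
    loopless : ∀ v → arc v v ≡ false

open Digraph public

_⟶_ : (G : Digraph) → Fin (n G) → Fin (n G) → Set
_⟶_ G u v = T (arc G u v)

outdeg : (G : Digraph) → Fin (n G) → ℕ
outdeg G u = length (filter (λ v → T? (arc G u v)) (allFin (n G)))

indeg : (G : Digraph) → Fin (n G) → ℕ
indeg G v = length (filter (λ w → T? (arc G w v)) (allFin (n G)))

No2Cycles : Digraph → Set
No2Cycles G = ∀ u v → (G ⟶ u) v → (G ⟶ v) u → ⊥

Dominated : (G : Digraph) → Fin (n G) → Fin (n G) → Set
Dominated G u v = ∃ λ w → (G ⟶ w) u × (G ⟶ w) v

AllArcsDominated : Digraph → Set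
AllArcsDominated G = ∀ u v → (G ⟶ u) v → Dominated G u v

-- Let d be the in-degree of v and c x the number of common in-neighbours of v and x.
-- Counting pairs (w, x) with w → v and w → x gives ∑ₓ c x = 3d, since each of the d
-- in-neighbours of v has out-degree 3. On the other hand c v = d, and c x ≥ 1 for each of
-- the d + 3 neighbours x of v (disjoint in- and out-neighbourhoods, as there are no
-- 2-cycles), because the arc between v and x is dominated. Hence 3d ≥ 2d + 3, i.e. d ≥ 3,
-- and since the in-degrees sum to the out-degrees, 3|V| in total, every in-degree is 3.
module Submission where

open import Defs
open import Data.Nat.Properties hiding (_≟_)
open import Algebra.Properties.Semiring.Sum +-*-semiring
  using (sum; sum-syntax; sum-cong-≗; sum-replicate-zero; ∑-comm; ∑-distrib-+; *-distribˡ-sum)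
open import Data.Bool using (Bool; true; false; T)
open import Data.Bool.Properties using (T?)
open import Data.Empty using (⊥-elim)
open import Data.Fin using (Fin; zero; suc)
open import Data.Fin.Properties using (_≟_)
open import Data.List using (length; filter; tabulate)
open import Data.Nat using (ℕ; zero; suc; _+_; _*_; _≤_; z≤n)
open import Data.Product using (_,_)
open import Function using (_∘_)
open import Relation.Binary.PropositionalEquality
open import Relation.Nullary using (does; yes; no)

toℕ : Bool → ℕ
toℕ true  = 1
toℕ false = 0

toℕ-*-idem : ∀ b → toℕ b * toℕ b ≡ toℕ b
toℕ-*-idem true  = refl
toℕ-*-idem false = refl

T⇒toℕ≡1 : ∀ {b} → T b → toℕ b ≡ 1
T⇒toℕ≡1 {true} _ = refl

δ : ∀ {n} → Fin n → Fin n → ℕ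
δ v x = toℕ (does (x ≟ v))

sum-δ : ∀ {n} (v : Fin n) → ∑[ x < n ] δ v x ≡ 1
sum-δ {suc n} zero    = cong suc (sum-replicate-zero n)
sum-δ {suc n} (suc v) = sum-δ v

sum-mono-≤ : ∀ {n} {f g : Fin n → ℕ} → (∀ i → f i ≤ g i) → sum f ≤ sum g
sum-mono-≤ {zero}  f≤g = z≤n
sum-mono-≤ {suc n} f≤g = +-mono-≤ (f≤g zero) (sum-mono-≤ (f≤g ∘ suc))

term≤sum : ∀ {n} (f : Fin n → ℕ) i → f i ≤ sum f
term≤sum f zero    = m≤m+n _ _
term≤sum f (suc i) = ≤-trans (term≤sum (f ∘ suc) i) (m≤n+m _ (f zero))

pointwise-≤∧sum-≤⇒≡ : ∀ {n} {f g : Fin n → ℕ} →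
  (∀ i → f i ≤ g i) → sum g ≤ sum f → ∀ i → f i ≡ g i
pointwise-≤∧sum-≤⇒≡ {suc n} {f} {g} f≤g ∑g≤∑f i = go i
  where
  tail≤ : sum (f ∘ suc) ≤ sum (g ∘ suc)
  tail≤ = sum-mono-≤ (f≤g ∘ suc)

  head≡ : f zero ≡ g zero
  head≡ = ≤-antisym (f≤g zero) (+-cancelʳ-≤ (sum (f ∘ suc)) (g zero) (f zero)
            (≤-trans (+-monoʳ-≤ (g zero) tail≤) ∑g≤∑f))

  go : ∀ i → f i ≡ g i
  go zero    = head≡
  go (suc i) = pointwise-≤∧sum-≤⇒≡ (f≤g ∘ suc)
    (+-cancelˡ-≤ (g zero) _ _ (subst (λ a → g zero + _ ≤ a + _) head≡ ∑g≤∑f)) i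

length-filter-tabulate : ∀ {A : Set} {n} (f : Fin n → A) (p : A → Bool) →
  length (filter (T? ∘ p) (tabulate f)) ≡ ∑[ i < n ] toℕ (p (f i))
length-filter-tabulate {n = zero}  f p = refl
length-filter-tabulate {n = suc n} f p with p (f zero)
... | true  = cong suc (length-filter-tabulate (f ∘ suc) p)
... | false = length-filter-tabulate (f ∘ suc) p

m+m+n≤3*m⇒n≤m : ∀ m n → m + m + n ≤ 3 * m → n ≤ m
m+m+n≤3*m⇒n≤m m n h = +-cancelˡ-≤ (m + m) n m (≤-trans h (≤-reflexive (begin
  m + (m + (m + 0)) ≡⟨ cong (λ k → m + (m + k)) (+-identityʳ m) ⟩
  m + (m + m)       ≡⟨ +-assoc m m m ⟨
  m + m + m         ∎)))
  where open ≡-Reasoning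

module _ (G : Digraph) where

  private
    V = Fin (n G)
    [_↦_] : V → V → ℕ
    [ u ↦ v ] = toℕ (arc G u v)

  outdeg-sum : ∀ u → outdeg G u ≡ ∑[ v < n G ] [ u ↦ v ]
  outdeg-sum u = length-filter-tabulate (λ v → v) (arc G u)

  indeg-sum : ∀ v → indeg G v ≡ ∑[ w < n G ] [ w ↦ v ]
  indeg-sum v = length-filter-tabulate (λ w → w) (λ w → arc G w v)

  sum-indeg≡sum-outdeg : ∑[ v < n G ] indeg G v ≡ ∑[ u < n G ] outdeg G u
  sum-indeg≡sum-outdeg = begin
    ∑[ v < n G ] indeg G v                        ≡⟨ sum-cong-≗ indeg-sum ⟩
    ∑[ v < n G ] ∑[ w < n G ] [ w ↦ v ]          ≡⟨ ∑-comm (λ v w → [ w ↦ v ]) ⟩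
    ∑[ w < n G ] ∑[ v < n G ] [ w ↦ v ]          ≡⟨ sum-cong-≗ outdeg-sum ⟨
    ∑[ u < n G ] outdeg G u                        ∎
    where open ≡-Reasoning

  commonIn : V → V → ℕ
  commonIn v x = ∑[ w < n G ] ([ w ↦ v ] * [ w ↦ x ])

  sum-commonIn : ∀ v → ∑[ x < n G ] commonIn v x ≡ ∑[ w < n G ] ([ w ↦ v ] * outdeg G w)
  sum-commonIn v = begin
    ∑[ x < n G ] ∑[ w < n G ] ([ w ↦ v ] * [ w ↦ x ])
      ≡⟨ ∑-comm (λ x w → [ w ↦ v ] * [ w ↦ x ]) ⟩
    ∑[ w < n G ] ∑[ x < n G ] ([ w ↦ v ] * [ w ↦ x ])
      ≡⟨ sum-cong-≗ (λ w → *-distribˡ-sum [ w ↦ v ] (λ x → [ w ↦ x ])) ⟨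
    ∑[ w < n G ] ([ w ↦ v ] * ∑[ x < n G ] [ w ↦ x ])
      ≡⟨ sum-cong-≗ (λ w → cong ([ w ↦ v ] *_) (outdeg-sum w)) ⟨
    ∑[ w < n G ] ([ w ↦ v ] * outdeg G w)
      ∎
    where open ≡-Reasoning

  commonIn-diag : ∀ v → commonIn v v ≡ indeg G v
  commonIn-diag v = trans (sum-cong-≗ (λ w → toℕ-*-idem (arc G w v))) (sym (indeg-sum v))

  sum-weighted-outdeg-regular : ∀ {k} → (∀ u → outdeg G u ≡ k) →
    ∀ v → ∑[ w < n G ] ([ w ↦ v ] * outdeg G w) ≡ k * indeg G v
  sum-weighted-outdeg-regular {k} outdeg≡k v = begin
    ∑[ w < n G ] ([ w ↦ v ] * outdeg G w)
      ≡⟨ sum-cong-≗ (λ w → trans (cong ([ w ↦ v ] *_) (outdeg≡k w)) (*-comm [ w ↦ v ] k)) ⟩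
    ∑[ w < n G ] (k * [ w ↦ v ])          ≡⟨ *-distribˡ-sum k (λ w → [ w ↦ v ]) ⟨
    k * ∑[ w < n G ] [ w ↦ v ]            ≡⟨ cong (k *_) (indeg-sum v) ⟨
    k * indeg G v                         ∎
    where open ≡-Reasoning

  commonIn-pos : ∀ {v x} w → (G ⟶ w) v → (G ⟶ w) x → 1 ≤ commonIn v x
  commonIn-pos {v} {x} w wv wx = begin
    1                          ≡⟨ cong₂ _*_ (T⇒toℕ≡1 wv) (T⇒toℕ≡1 wx) ⟨
    [ w ↦ v ] * [ w ↦ x ]      ≤⟨ term≤sum (λ w → [ w ↦ v ] * [ w ↦ x ]) w ⟩
    commonIn v x               ∎
    where open ≤-Reasoning

  module _ (no2Cycles : No2Cycles G) (dominated : AllArcsDominated G) where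

    adjacent⇒commonIn-pos : ∀ v x → [ x ↦ v ] + [ v ↦ x ] ≤ commonIn v x
    adjacent⇒commonIn-pos v x with arc G x v in xv | arc G v x in vx
    ... | false | false = z≤n
    ... | true  | true  = ⊥-elim (no2Cycles x v (subst T (sym xv) _) (subst T (sym vx) _))
    ... | true  | false = let w , wx , wv = dominated x v (subst T (sym xv) _)
                          in commonIn-pos w wv wx
    ... | false | true  = let w , wv , wx = dominated v x (subst T (sym vx) _)
                          in commonIn-pos w wv wx

    commonIn-lower : ∀ v x → indeg G v * δ v x + ([ x ↦ v ] + [ v ↦ x ]) ≤ commonIn v x
    commonIn-lower v x with x ≟ v
    ... | yes refl rewrite loopless G v =
      ≤-reflexive (trans (+-identityʳ _) (trans (*-identityʳ _) (sym (commonIn-diag v))))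
    ... | no _ =
      subst (_≤ commonIn v x) (cong (_+ ([ x ↦ v ] + [ v ↦ x ])) (sym (*-zeroʳ (indeg G v))))
            (adjacent⇒commonIn-pos v x)

    indeg-lower : ∀ v → indeg G v + indeg G v + outdeg G v ≤ ∑[ w < n G ] ([ w ↦ v ] * outdeg G w)
    indeg-lower v = begin
      indeg G v + indeg G v + outdeg G v
        ≡⟨ +-assoc (indeg G v) _ _ ⟩
      indeg G v + (indeg G v + outdeg G v)
        ≡⟨ cong₂ _+_ (sym (trans (cong (indeg G v *_) (sum-δ v)) (*-identityʳ (indeg G v))))
                     (cong₂ _+_ (indeg-sum v) (outdeg-sum v)) ⟩
      indeg G v * ∑[ x < n G ] δ v x + (∑[ x < n G ] [ x ↦ v ] + ∑[ x < n G ] [ v ↦ x ])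
        ≡⟨ cong₂ _+_ (*-distribˡ-sum (indeg G v) (δ v))
                     (sym (∑-distrib-+ (λ x → [ x ↦ v ]) (λ x → [ v ↦ x ]))) ⟩
      ∑[ x < n G ] (indeg G v * δ v x) + ∑[ x < n G ] ([ x ↦ v ] + [ v ↦ x ])
        ≡⟨ ∑-distrib-+ (λ x → indeg G v * δ v x) (λ x → [ x ↦ v ] + [ v ↦ x ]) ⟨
      ∑[ x < n G ] (indeg G v * δ v x + ([ x ↦ v ] + [ v ↦ x ]))
        ≤⟨ sum-mono-≤ (commonIn-lower v) ⟩
      ∑[ x < n G ] commonIn v x
        ≡⟨ sum-commonIn v ⟩
      ∑[ w < n G ] ([ w ↦ v ] * outdeg G w) ∎
      where open ≤-Reasoning

lemma3p1 : (G : Digraph) → No2Cycles G → AllArcsDominated G →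
    (∀ u → outdeg G u ≡ 3) → ∀ v → indeg G v ≡ 3
lemma3p1 G no2Cycles dominated outdeg≡3 v =
  sym (pointwise-≤∧sum-≤⇒≡ 3≤indeg ∑indeg≤∑3 v)
  where
  3≤indeg : ∀ v → 3 ≤ indeg G v
  3≤indeg v = m+m+n≤3*m⇒n≤m (indeg G v) 3 (begin
    indeg G v + indeg G v + 3                 ≡⟨ cong (indeg G v + indeg G v +_) (outdeg≡3 v) ⟨
    indeg G v + indeg G v + outdeg G v        ≤⟨ indeg-lower G no2Cycles dominated v ⟩
    _                                         ≡⟨ sum-weighted-outdeg-regular G outdeg≡3 v ⟩
    3 * indeg G v                             ∎)
    where open ≤-Reasoning

  ∑indeg≤∑3 : ∑[ v < n G ] indeg G v ≤ ∑[ v < n G ] 3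
  ∑indeg≤∑3 = ≤-reflexive (trans (sum-indeg≡sum-outdeg G) (sum-cong-≗ outdeg≡3))
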